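{- Let $B$ be a Boolean algebra and $n\geq 1$ an integer. Let $$B^{[n]}=\{f:\{1,2,\ldots,n\}\to B \;:\; f(i)\leq f(j)\text{ whenever } i\leq j\},$$ let $\mathbb I\in B^{[n]}$ be the constant function with value $1$, and for $f,g\in B^{[n]}$ and $1\leq k\leq n$ define $$(\neg f)(k)=\neg f(n+1-k),\qquad (f\Rightarrow g)(k)=\bigwedge_{i=1}^{n-k+1}\bigl(f(i)\to g(i+k-1)\bigr),$$ where $a\to b=\neg a\vee b$ in $B$. Then $\langle B^{[n]},\Rightarrow,\neg,\mathbb I\rangle$ is an $(n+1)$-valued Wajsberg algebra.
   Context: A Wajsberg algebra is an algebra $\langle A,\to,\neg,1\rangle$ of type $(2,1,0)$ satisfying $1\to x=x$, $(x\to y)\to((y\to z)\to(x\to z))=1$, $(x\to y)\to y=(y\to x)\to x$, and $(\neg y\to\neg x)\to(x\to y)=1$. For an integer $n\ge 1$, $L_{n+1}$ denotes the Wajsberg algebra with universe $\{0,\frac1n,\ldots,\frac{n-1}{n},1\}$ and operations $x\to y=\min\{1,1-x+y\}$, $\neg x=1-x$. An $(n+1)$-valued Wajsberg algebra is a Wajsberg algebra belonging to the variety generated by $L_{n+1}$. -}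

module Defs where

open import Level using (Level; _⊔_)
open import Data.Nat using (ℕ; zero; suc; _∸_; _+_; _≤_)
open import Data.Fin using (Fin; toℕ; opposite)
import Data.Fin as F
open import Data.List using (List; foldr; map; upTo)
open import Data.Product using (_×_)
open import Relation.Binary.PropositionalEquality using (_≡_)
open import Algebra.Lattice.Bundles using (BooleanAlgebra)

data Term : Set where
  var  : ℕ → Term
  _⇒ₜ_ : Term → Term → Term
  ¬ₜ_  : Term → Term
  1ₜ   : Term

-- A (possibly relativised) algebra of type (2,1,0):
-- raw carrier A, an equality _≈_, operations, and a predicate P
-- carving out the universe (the universe is { x | P x }).

module Alg {a ℓ p : Level} {A : Set a} (_≈_ : A → A → Set ℓ)
           (_⟶_ : A → A → A) (∼_ : A → A) (one : A) (P : A → Set p) where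

  eval : (ℕ → A) → Term → A
  eval ρ (var i)  = ρ i
  eval ρ (s ⇒ₜ t) = eval ρ s ⟶ eval ρ t
  eval ρ (¬ₜ s)   = ∼ eval ρ s
  eval ρ 1ₜ       = one

  Satisfies : Term → Term → Set (a ⊔ ℓ ⊔ p)
  Satisfies s t = (ρ : ℕ → A) → (∀ i → P (ρ i)) → eval ρ s ≈ eval ρ t

  Closed : Set (a ⊔ p)
  Closed = (∀ x y → P x → P y → P (x ⟶ y)) × (∀ x → P x → P (∼ x)) × P one

  Congruent : Set (a ⊔ ℓ ⊔ p)
  Congruent =
    (∀ x → P x → x ≈ x) ×
    (∀ x y → P x → P y → x ≈ y → y ≈ x) ×
    (∀ x y z → P x → P y → P z → x ≈ y → y ≈ z → x ≈ z) ×
    (∀ x x' y y' → P x → P x' → P y → P y' → x ≈ x' → y ≈ y' → (x ⟶ y) ≈ (x' ⟶ y')) ×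
    (∀ x x' → P x → P x' → x ≈ x' → (∼ x) ≈ (∼ x'))

  IsWajsberg : Set (a ⊔ ℓ ⊔ p)
  IsWajsberg =
    Closed × Congruent ×
    (∀ x → P x → (one ⟶ x) ≈ x) ×
    (∀ x y z → P x → P y → P z →
       ((x ⟶ y) ⟶ ((y ⟶ z) ⟶ (x ⟶ z))) ≈ one) ×
    (∀ x y → P x → P y → ((x ⟶ y) ⟶ y) ≈ ((y ⟶ x) ⟶ x)) ×
    (∀ x y → P x → P y → (((∼ y) ⟶ (∼ x)) ⟶ (x ⟶ y)) ≈ one)

-- The MV-chain L_{n+1}: the element k/n is represented by k ≤ n.
-- x → y = min(1, 1 - x + y)  becomes  n ∸ (x ∸ y);  ¬x = 1 - x becomes n ∸ x.

L-imp : ℕ → ℕ → ℕ → ℕ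
L-imp n x y = n ∸ (x ∸ y)

L-neg : ℕ → ℕ → ℕ
L-neg n x = n ∸ x

L-Satisfies : ℕ → Term → Term → Set
L-Satisfies n = Alg.Satisfies _≡_ (L-imp n) (L-neg n) n (λ x → x ≤ n)

-- (n+1)-valued Wajsberg algebra: a Wajsberg algebra lying in the variety
-- generated by L_{n+1}, i.e. satisfying every identity valid in L_{n+1}.
IsNValuedWajsberg : {a ℓ p : Level} {A : Set a} (n : ℕ) (_≈_ : A → A → Set ℓ)
  (_⟶_ : A → A → A) (∼_ : A → A) (one : A) (P : A → Set p) → Set (a ⊔ ℓ ⊔ p)
IsNValuedWajsberg n _≈_ _⟶_ ∼_ one P =
  Alg.IsWajsberg _≈_ _⟶_ ∼_ one P ×
  (∀ s t → L-Satisfies n s t → Alg.Satisfies _≈_ _⟶_ ∼_ one P s t)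

-- The construction B^[n] (indices 1..n are represented by Fin n, 0-based).

module BN {c ℓ : Level} (B : BooleanAlgebra c ℓ) (n : ℕ) where
  open BooleanAlgebra B

  _≤B_ : Carrier → Carrier → Set ℓ
  a ≤B b = (a ∧ b) ≈ a

  _→B_ : Carrier → Carrier → Carrier
  a →B b = (¬ a) ∨ b

  Fun : Set c
  Fun = Fin n → Carrier

  Mono : Fun → Set ℓ
  Mono f = ∀ i j → toℕ i ≤ toℕ j → f i ≤B f j

  _≈ₙ_ : Fun → Fun → Set ℓ
  f ≈ₙ g = ∀ i → f i ≈ g i

  𝕀 : Fun
  𝕀 _ = ⊤

  -- (¬f)(k) = ¬ f(n+1-k); 0-based: k ↦ n-1-k = opposite k
  neg : Fun → Fun
  neg f k = ¬ f (opposite k)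

  -- extension of f to ℕ-indices (value ⊤ outside 0..n-1; never used below)
  ext : {m : ℕ} → (Fin m → Carrier) → ℕ → Carrier
  ext {zero}  f j       = ⊤
  ext {suc m} f zero    = f F.zero
  ext {suc m} f (suc j) = ext (λ i → f (F.suc i)) j

  -- (f ⇒ g)(k) = ⋀_{i=1}^{n-k+1} (f(i) → g(i+k-1));
  -- 0-based: k' = k-1, i' = i-1 ranges over 0 .. n-1-k', and g is taken at i'+k'.
  imp : Fun → Fun → Fun
  imp f g k = foldr _∧_ ⊤
    (map (λ i → ext f i →B ext g (i + toℕ k)) (upTo (n ∸ toℕ k)))

-- Each coordinate of a Wajsberg term evaluated in B^[n] is a Boolean polynomial in the coordinates of
-- its arguments, so an identity holds in B^[n] as soon as the corresponding Boolean identities hold in the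
-- two-element algebra 𝔹 (two-valued completeness, by Shannon expansion). Monotonicity of the arguments is
-- built into these polynomials by writing the i-th coordinate of f as f(1) ∨ … ∨ f(i). Over 𝔹 the monotone
-- functions are the thresholds, which are the images of the elements c/n under an isomorphism
-- L_{n+1} ≅ 𝔹^[n]. Hence every identity of L_{n+1}, in particular each Wajsberg axiom, holds in B^[n], and
-- monotonicity of the operations is such a Boolean identity as well.
module Submission where

open import Defs
open import Level using (Level; 0ℓ)
open import Algebra.Bundles using (IdempotentCommutativeMonoid)
open import Algebra.Lattice.Bundles using (BooleanAlgebra)
open import Data.Bool using (Bool; true; false; not) renaming (_∧_ to _∧ᵇ_; _∨_ to _∨ᵇ_)
open import Data.Bool.Properties using (∨-∧-booleanAlgebra)
open import Data.Bool.ListAction using (and; all)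
open import Data.Empty using (⊥-elim)
open import Data.Fin as Fin using (Fin; zero; suc; toℕ; opposite; fromℕ<)
open import Data.Fin.Properties using (toℕ<n; opposite-prop; toℕ-fromℕ<)
open import Data.List using (List; []; _∷_; foldr; map; upTo; allFin; cartesianProduct)
open import Data.List.Properties using (map-cong)
open import Data.List.Membership.Propositional using (_∈_)
open import Data.List.Membership.Propositional.Properties using (∈-upTo⁺; ∈-upTo⁻; ∈-allFin; ∈-cartesianProduct⁺)
open import Data.List.Relation.Unary.All as All using (All; all?)
open import Data.List.Relation.Unary.Any using (here; there)
open import Data.Nat using (ℕ; zero; suc; _+_; _∸_; _<_; _≤_; _⊔_; z≤n; s≤s; _≤ᵇ_)
open import Data.Nat.Properties
open import Data.Product using (∃; _×_; _,_; proj₁; proj₂)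
open import Data.Product.Properties using (≡-dec)
open import Data.Sum using (_⊎_; inj₁; inj₂)
open import Function using (_∘_; _⇔_; mk⇔; Equivalence)
open import Relation.Binary.Definitions using (DecidableEquality)
open import Relation.Binary.PropositionalEquality as ≡ using (_≡_)
open import Relation.Nullary using (yes; no; does; ¬?; _×-dec_; _→-dec_; contradiction)
open import Relation.Nullary.Decidable using (dec-true; dec-false; does-⇔)
open import Relation.Unary using (Decidable)

-- Boolean expressions and two-valued completeness

infixr 7 _∧ₑ_
infixr 6 _∨ₑ_
infix 8 ¬ₑ_

data BoolExpr (X : Set) : Set where
  atom      : X → BoolExpr X
  ⊤ₑ ⊥ₑ     : BoolExpr X
  _∧ₑ_ _∨ₑ_ : BoolExpr X → BoolExpr X → BoolExpr X
  ¬ₑ_       : BoolExpr X → BoolExpr X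

prefixJoin : ∀ {a} {A : Set a} {m} → (A → A → A) → (Fin m → A) → Fin m → A
prefixJoin _∨_ f zero    = f zero
prefixJoin _∨_ f (suc i) = f zero ∨ prefixJoin _∨_ (f ∘ suc) i

module Semantics {c ℓ : Level} (B : BooleanAlgebra c ℓ) where
  open BooleanAlgebra B
  open import Algebra.Lattice.Properties.BooleanAlgebra B
  open import Relation.Binary.Reasoning.Setoid setoid

  ⟦_⟧ : {X : Set} → BoolExpr X → (X → Carrier) → Carrier
  ⟦ atom x ⟧ σ = σ x
  ⟦ ⊤ₑ     ⟧ σ = ⊤
  ⟦ ⊥ₑ     ⟧ σ = ⊥
  ⟦ p ∧ₑ q ⟧ σ = ⟦ p ⟧ σ ∧ ⟦ q ⟧ σ
  ⟦ p ∨ₑ q ⟧ σ = ⟦ p ⟧ σ ∨ ⟦ q ⟧ σ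
  ⟦ ¬ₑ p   ⟧ σ = ¬ ⟦ p ⟧ σ

  ⟦⟧-cong : ∀ {X} (p : BoolExpr X) {σ σ′ : X → Carrier} →
            (∀ x → σ x ≈ σ′ x) → ⟦ p ⟧ σ ≈ ⟦ p ⟧ σ′
  ⟦⟧-cong (atom x) σ≈σ′ = σ≈σ′ x
  ⟦⟧-cong ⊤ₑ       σ≈σ′ = refl
  ⟦⟧-cong ⊥ₑ       σ≈σ′ = refl
  ⟦⟧-cong (p ∧ₑ q) σ≈σ′ = ∧-cong (⟦⟧-cong p σ≈σ′) (⟦⟧-cong q σ≈σ′)
  ⟦⟧-cong (p ∨ₑ q) σ≈σ′ = ∨-cong (⟦⟧-cong p σ≈σ′) (⟦⟧-cong q σ≈σ′)
  ⟦⟧-cong (¬ₑ p)   σ≈σ′ = ¬-cong (⟦⟧-cong p σ≈σ′)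

  ∧-⊤-idempotentCommutativeMonoid : IdempotentCommutativeMonoid c ℓ
  ∧-⊤-idempotentCommutativeMonoid = record
    { isIdempotentCommutativeMonoid = record
      { isCommutativeMonoid = ∧-⊤-isCommutativeMonoid
      ; idem                = ∧-idem
      }
    }

  open import Algebra.Properties.IdempotentCommutativeMonoid ∧-⊤-idempotentCommutativeMonoid
    using () renaming (∙-distrˡ-∙ to ∧-distribˡ-∧)

  ∧-¬-relative : ∀ a x → a ∧ ¬ x ≈ a ∧ ¬ (a ∧ x)
  ∧-¬-relative a x = sym (begin
    a ∧ ¬ (a ∧ x)          ≈⟨ ∧-congˡ (deMorgan₁ a x) ⟩
    a ∧ (¬ a ∨ ¬ x)        ≈⟨ ∧-distribˡ-∨ a (¬ a) (¬ x) ⟩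
    (a ∧ ¬ a) ∨ (a ∧ ¬ x)  ≈⟨ ∨-congʳ (∧-complementʳ a) ⟩
    ⊥ ∨ (a ∧ ¬ x)          ≈⟨ ∨-identityˡ _ ⟩
    a ∧ ¬ x                ∎)

  -- In the Boolean algebra ↓a (operations x ∧ y, x ∨ y, a ∧ ¬ x), x ↦ a ∧ x is a homomorphism.
  ∧-⟦⟧-cong : ∀ {X} (a : Carrier) {σ σ′ : X → Carrier} →
              (∀ x → a ∧ σ x ≈ a ∧ σ′ x) → ∀ p → a ∧ ⟦ p ⟧ σ ≈ a ∧ ⟦ p ⟧ σ′
  ∧-⟦⟧-cong a σ≈σ′ (atom x) = σ≈σ′ x
  ∧-⟦⟧-cong a σ≈σ′ ⊤ₑ       = refl
  ∧-⟦⟧-cong a σ≈σ′ ⊥ₑ       = refl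
  ∧-⟦⟧-cong a {σ} {σ′} σ≈σ′ (p ∧ₑ q) = begin
    a ∧ (⟦ p ⟧ σ ∧ ⟦ q ⟧ σ)           ≈⟨ ∧-distribˡ-∧ a _ _ ⟩
    (a ∧ ⟦ p ⟧ σ) ∧ (a ∧ ⟦ q ⟧ σ)     ≈⟨ ∧-cong (∧-⟦⟧-cong a σ≈σ′ p) (∧-⟦⟧-cong a σ≈σ′ q) ⟩
    (a ∧ ⟦ p ⟧ σ′) ∧ (a ∧ ⟦ q ⟧ σ′)   ≈⟨ ∧-distribˡ-∧ a _ _ ⟨
    a ∧ (⟦ p ⟧ σ′ ∧ ⟦ q ⟧ σ′)         ∎
  ∧-⟦⟧-cong a {σ} {σ′} σ≈σ′ (p ∨ₑ q) = begin
    a ∧ (⟦ p ⟧ σ ∨ ⟦ q ⟧ σ)           ≈⟨ ∧-distribˡ-∨ a _ _ ⟩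
    (a ∧ ⟦ p ⟧ σ) ∨ (a ∧ ⟦ q ⟧ σ)     ≈⟨ ∨-cong (∧-⟦⟧-cong a σ≈σ′ p) (∧-⟦⟧-cong a σ≈σ′ q) ⟩
    (a ∧ ⟦ p ⟧ σ′) ∨ (a ∧ ⟦ q ⟧ σ′)   ≈⟨ ∧-distribˡ-∨ a _ _ ⟨
    a ∧ (⟦ p ⟧ σ′ ∨ ⟦ q ⟧ σ′)         ∎
  ∧-⟦⟧-cong a {σ} {σ′} σ≈σ′ (¬ₑ p) = begin
    a ∧ ¬ ⟦ p ⟧ σ             ≈⟨ ∧-¬-relative a _ ⟩
    a ∧ ¬ (a ∧ ⟦ p ⟧ σ)       ≈⟨ ∧-congˡ (¬-cong (∧-⟦⟧-cong a σ≈σ′ p)) ⟩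
    a ∧ ¬ (a ∧ ⟦ p ⟧ σ′)      ≈⟨ ∧-¬-relative a _ ⟨
    a ∧ ¬ ⟦ p ⟧ σ′            ∎

  ⟦⟧-prefixJoin : ∀ {X m} (F : Fin m → BoolExpr X) σ i →
                  ⟦ prefixJoin _∨ₑ_ F i ⟧ σ ≡ prefixJoin _∨_ (λ j → ⟦ F j ⟧ σ) i
  ⟦⟧-prefixJoin F σ zero    = ≡.refl
  ⟦⟧-prefixJoin F σ (suc i) = ≡.cong (⟦ F zero ⟧ σ ∨_) (⟦⟧-prefixJoin (F ∘ suc) σ i)

𝔹 : BooleanAlgebra 0ℓ 0ℓ
𝔹 = ∨-∧-booleanAlgebra

open Semantics 𝔹 using () renaming (⟦_⟧ to ⟦_⟧₂)

module TwoValuedCompleteness {c ℓ : Level} (B : BooleanAlgebra c ℓ) where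
  open BooleanAlgebra B
  open import Algebra.Lattice.Properties.BooleanAlgebra B
  open import Relation.Binary.Reasoning.Setoid setoid
  open Semantics B

  embed : Bool → Carrier
  embed true  = ⊤
  embed false = ⊥

  ⟦⟧-embed : ∀ {X} (p : BoolExpr X) τ → ⟦ p ⟧ (embed ∘ τ) ≈ embed (⟦ p ⟧₂ τ)
  ⟦⟧-embed (atom x) τ = refl
  ⟦⟧-embed ⊤ₑ       τ = refl
  ⟦⟧-embed ⊥ₑ       τ = refl
  ⟦⟧-embed (p ∧ₑ q) τ = trans (∧-cong (⟦⟧-embed p τ) (⟦⟧-embed q τ)) (embed-∧ (⟦ p ⟧₂ τ) (⟦ q ⟧₂ τ))
    where
    embed-∧ : ∀ x y → embed x ∧ embed y ≈ embed (x ∧ᵇ y)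
    embed-∧ true  true  = ∧-idem ⊤
    embed-∧ true  false = ∧-zeroʳ ⊤
    embed-∧ false y     = ∧-zeroˡ _
  ⟦⟧-embed (p ∨ₑ q) τ = trans (∨-cong (⟦⟧-embed p τ) (⟦⟧-embed q τ)) (embed-∨ (⟦ p ⟧₂ τ) (⟦ q ⟧₂ τ))
    where
    embed-∨ : ∀ x y → embed x ∨ embed y ≈ embed (x ∨ᵇ y)
    embed-∨ true  y = ∨-zeroˡ _
    embed-∨ false y = ∨-identityˡ _
  ⟦⟧-embed (¬ₑ p)   τ = trans (¬-cong (⟦⟧-embed p τ)) (embed-¬ (⟦ p ⟧₂ τ))
    where
    embed-¬ : ∀ x → ¬ embed x ≈ embed (not x)
    embed-¬ true  = ¬⊤≈⊥
    embed-¬ false = ¬⊥≈⊤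

  ≈-by-cases : ∀ a {u v} → a ∧ u ≈ a ∧ v → ¬ a ∧ u ≈ ¬ a ∧ v → u ≈ v
  ≈-by-cases a {u} {v} a∧u≈a∧v ¬a∧u≈¬a∧v = begin
    u                    ≈⟨ ∧-identityˡ u ⟨
    ⊤ ∧ u                ≈⟨ ∧-congʳ (∨-complementʳ a) ⟨
    (a ∨ ¬ a) ∧ u        ≈⟨ ∧-distribʳ-∨ u a (¬ a) ⟩
    (a ∧ u) ∨ (¬ a ∧ u)  ≈⟨ ∨-cong a∧u≈a∧v ¬a∧u≈¬a∧v ⟩
    (a ∧ v) ∨ (¬ a ∧ v)  ≈⟨ ∧-distribʳ-∨ v a (¬ a) ⟨
    (a ∨ ¬ a) ∧ v        ≈⟨ ∧-congʳ (∨-complementʳ a) ⟩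
    ⊤ ∧ v                ≈⟨ ∧-identityˡ v ⟩
    v                    ∎

  module _ {X : Set} (_≟_ : DecidableEquality X) (p q : BoolExpr X)
           (p≈q-in-𝔹 : ∀ τ → ⟦ p ⟧₂ τ ≡ ⟦ q ⟧₂ τ) where

    _[_↦_] : (X → Carrier) → X → Carrier → X → Carrier
    (σ [ x ↦ a ]) y with y ≟ x
    ... | yes _ = a
    ... | no  _ = σ y

    TwoValuedOutside : List X → (X → Carrier) → Set ℓ
    TwoValuedOutside xs σ = ∀ x → x ∈ xs ⊎ ∃ λ b → σ x ≈ embed b

    -- Shannon expansion along the variables of xs, one at a time.
    ≈-if-TwoValuedOutside : ∀ xs σ → TwoValuedOutside xs σ → ⟦ p ⟧ σ ≈ ⟦ q ⟧ σ
    ≈-if-TwoValuedOutside [] σ σ-two-valued = begin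
      ⟦ p ⟧ σ              ≈⟨ ⟦⟧-cong p (proj₂ ∘ value) ⟩
      ⟦ p ⟧ (embed ∘ τ)    ≈⟨ ⟦⟧-embed p τ ⟩
      embed (⟦ p ⟧₂ τ)     ≡⟨ ≡.cong embed (p≈q-in-𝔹 τ) ⟩
      embed (⟦ q ⟧₂ τ)     ≈⟨ ⟦⟧-embed q τ ⟨
      ⟦ q ⟧ (embed ∘ τ)    ≈⟨ ⟦⟧-cong q (proj₂ ∘ value) ⟨
      ⟦ q ⟧ σ              ∎
      where
      value : ∀ x → ∃ λ b → σ x ≈ embed b
      value x with σ-two-valued x
      ... | inj₂ b = b
      τ : X → Bool
      τ = proj₁ ∘ value
    ≈-if-TwoValuedOutside (x ∷ xs) σ σ-two-valued =
      ≈-by-cases (σ x) (relative (σ x) true at-⊤) (relative (¬ σ x) false at-⊥)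
      where
      fix : ∀ b → TwoValuedOutside xs (σ [ x ↦ embed b ])
      fix b y with y ≟ x
      ... | yes _ = inj₂ (b , refl)
      ... | no y≢x with σ-two-valued y
      ...   | inj₁ (here y≡x)   = ⊥-elim (y≢x y≡x)
      ...   | inj₁ (there y∈xs) = inj₁ y∈xs
      ...   | inj₂ b′           = inj₂ b′

      at-⊤ : ∀ y → σ x ∧ σ y ≈ σ x ∧ (σ [ x ↦ ⊤ ]) y
      at-⊤ y with y ≟ x
      ... | yes ≡.refl = trans (∧-idem _) (sym (∧-identityʳ _))
      ... | no  _      = refl

      at-⊥ : ∀ y → ¬ σ x ∧ σ y ≈ ¬ σ x ∧ (σ [ x ↦ ⊥ ]) y
      at-⊥ y with y ≟ x
      ... | yes ≡.refl = trans (∧-complementˡ _) (sym (∧-zeroʳ _))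
      ... | no  _      = refl

      relative : ∀ a b → (∀ y → a ∧ σ y ≈ a ∧ (σ [ x ↦ embed b ]) y) → a ∧ ⟦ p ⟧ σ ≈ a ∧ ⟦ q ⟧ σ
      relative a b σ≈σ′ = begin
        a ∧ ⟦ p ⟧ σ                       ≈⟨ ∧-⟦⟧-cong a σ≈σ′ p ⟩
        a ∧ ⟦ p ⟧ (σ [ x ↦ embed b ])     ≈⟨ ∧-congˡ (≈-if-TwoValuedOutside xs _ (fix b)) ⟩
        a ∧ ⟦ q ⟧ (σ [ x ↦ embed b ])     ≈⟨ ∧-⟦⟧-cong a σ≈σ′ q ⟨
        a ∧ ⟦ q ⟧ σ                       ∎

    two-valued-complete : (xs : List X) → (∀ x → x ∈ xs) → ∀ σ → ⟦ p ⟧ σ ≈ ⟦ q ⟧ σ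
    two-valued-complete xs enumerates σ = ≈-if-TwoValuedOutside xs σ (inj₁ ∘ enumerates)

-- Wajsberg terms in B^[n] as coordinatewise Boolean expressions

varBound : Term → ℕ
varBound (var i)  = suc i
varBound (s ⇒ₜ t) = varBound s ⊔ varBound t
varBound (¬ₜ s)   = varBound s
varBound 1ₜ       = 0

module Translation (n : ℕ) {X : Set} where

  extₑ : ∀ {m} → (Fin m → BoolExpr X) → ℕ → BoolExpr X
  extₑ {zero}  F j       = ⊤ₑ
  extₑ {suc m} F zero    = F zero
  extₑ {suc m} F (suc j) = extₑ (F ∘ suc) j

  impₑ : (Fin n → BoolExpr X) → (Fin n → BoolExpr X) → Fin n → BoolExpr X
  impₑ F G k = foldr _∧ₑ_ ⊤ₑ (map (λ i → ¬ₑ extₑ F i ∨ₑ extₑ G (i + toℕ k)) (upTo (n ∸ toℕ k)))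

  negₑ : (Fin n → BoolExpr X) → Fin n → BoolExpr X
  negₑ F k = ¬ₑ F (opposite k)

  translate : (ℕ → Fin n → BoolExpr X) → Term → Fin n → BoolExpr X
  translate R (var v)  = R v
  translate R (s ⇒ₜ t) = impₑ (translate R s) (translate R t)
  translate R (¬ₜ s)   = negₑ (translate R s)
  translate R 1ₜ       = λ _ → ⊤ₑ

module BooleanPower {c ℓ : Level} (B : BooleanAlgebra c ℓ) (n : ℕ) where
  open BooleanAlgebra B
  open import Algebra.Lattice.Properties.BooleanAlgebra B using (∧-idem)
  open import Relation.Binary.Reasoning.Setoid setoid
  open BN B n
  open Semantics B

  evalⁿ : (ℕ → Fun) → Term → Fun
  evalⁿ = Alg.eval _≈ₙ_ imp neg 𝕀 Mono

  ext-cong : ∀ {m} {f f′ : Fin m → Carrier} → (∀ i → f i ≈ f′ i) → ∀ j → ext f j ≈ ext f′ j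
  ext-cong {zero}  f≈f′ j       = refl
  ext-cong {suc m} f≈f′ zero    = f≈f′ zero
  ext-cong {suc m} f≈f′ (suc j) = ext-cong (f≈f′ ∘ suc) j

  ext-toℕ : ∀ {m} (h : ℕ → Carrier) → (∀ j → m ≤ j → h j ≡ ⊤) → ∀ j → ext {m} (h ∘ toℕ) j ≡ h j
  ext-toℕ {zero}  h h≡⊤ j       = ≡.sym (h≡⊤ j z≤n)
  ext-toℕ {suc m} h h≡⊤ zero    = ≡.refl
  ext-toℕ {suc m} h h≡⊤ (suc j) = ext-toℕ (h ∘ suc) (λ j m≤j → h≡⊤ (suc j) (s≤s m≤j)) j

  ⋀-cong : ∀ {H H′ : ℕ → Carrier} → (∀ i → H i ≈ H′ i) →
           ∀ is → foldr _∧_ ⊤ (map H is) ≈ foldr _∧_ ⊤ (map H′ is)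
  ⋀-cong H≈H′ []       = refl
  ⋀-cong H≈H′ (i ∷ is) = ∧-cong (H≈H′ i) (⋀-cong H≈H′ is)

  imp-cong : ∀ {f f′ g g′} → f ≈ₙ f′ → g ≈ₙ g′ → imp f g ≈ₙ imp f′ g′
  imp-cong f≈f′ g≈g′ k =
    ⋀-cong (λ i → ∨-cong (¬-cong (ext-cong f≈f′ i)) (ext-cong g≈g′ (i + toℕ k))) (upTo (n ∸ toℕ k))

  neg-cong : ∀ {f f′} → f ≈ₙ f′ → neg f ≈ₙ neg f′
  neg-cong f≈f′ k = ¬-cong (f≈f′ (opposite k))

  prefixJoin-Mono : ∀ {m} (f : Fin m → Carrier) → BN.Mono B m f → ∀ i → prefixJoin _∨_ f i ≈ f i
  prefixJoin-Mono f f-mono zero    = refl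
  prefixJoin-Mono f f-mono (suc i) = begin
    f zero ∨ prefixJoin _∨_ (f ∘ suc) i  ≈⟨ ∨-congˡ (prefixJoin-Mono (f ∘ suc) (λ a b a≤b → f-mono (suc a) (suc b) (s≤s a≤b)) i) ⟩
    f zero ∨ f (suc i)                   ≈⟨ ∨-congʳ (f-mono zero (suc i) z≤n) ⟨
    (f zero ∧ f (suc i)) ∨ f (suc i)     ≈⟨ ∨-comm _ _ ⟩
    f (suc i) ∨ (f zero ∧ f (suc i))     ≈⟨ ∨-congˡ (∧-comm _ _) ⟩
    f (suc i) ∨ (f (suc i) ∧ f zero)     ≈⟨ ∨-absorbs-∧ _ _ ⟩
    f (suc i)                            ∎

  𝕀-Mono : Mono 𝕀
  𝕀-Mono _ _ _ = ∧-idem ⊤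

  evalⁿ-cong : ∀ s {ρ ρ′} → (∀ v → v < varBound s → ρ v ≈ₙ ρ′ v) → evalⁿ ρ s ≈ₙ evalⁿ ρ′ s
  evalⁿ-cong (var v)  ρ≈ρ′ = ρ≈ρ′ v ≤-refl
  evalⁿ-cong (s ⇒ₜ t) ρ≈ρ′ = imp-cong
    (evalⁿ-cong s (λ v v< → ρ≈ρ′ v (m<n⇒m<n⊔o (varBound t) v<)))
    (evalⁿ-cong t (λ v v< → ρ≈ρ′ v (m<n⇒m<o⊔n (varBound s) v<)))
  evalⁿ-cong (¬ₜ s)   ρ≈ρ′ = neg-cong (evalⁿ-cong s ρ≈ρ′)
  evalⁿ-cong 1ₜ       ρ≈ρ′ = λ _ → refl

  module _ {X : Set} (σ : X → Carrier) where
    open Translation n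

    ⟦⟧-extₑ : ∀ {m} (F : Fin m → BoolExpr X) j → ⟦ extₑ F j ⟧ σ ≡ ext (λ i → ⟦ F i ⟧ σ) j
    ⟦⟧-extₑ {zero}  F j       = ≡.refl
    ⟦⟧-extₑ {suc m} F zero    = ≡.refl
    ⟦⟧-extₑ {suc m} F (suc j) = ⟦⟧-extₑ (F ∘ suc) j

    ⟦⟧-impₑ : ∀ F G k → ⟦ impₑ F G k ⟧ σ ≡ imp (λ i → ⟦ F i ⟧ σ) (λ i → ⟦ G i ⟧ σ) k
    ⟦⟧-impₑ F G k = ⟦⟧-⋀ (upTo (n ∸ toℕ k))
      where
      ⟦⟧-⋀ : ∀ is → ⟦ foldr _∧ₑ_ ⊤ₑ (map (λ i → ¬ₑ extₑ F i ∨ₑ extₑ G (i + toℕ k)) is) ⟧ σ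
                  ≡ foldr _∧_ ⊤ (map (λ i → ¬ ext (λ j → ⟦ F j ⟧ σ) i ∨ ext (λ j → ⟦ G j ⟧ σ) (i + toℕ k)) is)
      ⟦⟧-⋀ []       = ≡.refl
      ⟦⟧-⋀ (i ∷ is) = ≡.cong₂ _∧_ (≡.cong₂ (λ a b → ¬ a ∨ b) (⟦⟧-extₑ F i) (⟦⟧-extₑ G (i + toℕ k))) (⟦⟧-⋀ is)

    ⟦⟧-translate : ∀ R s → (λ k → ⟦ translate R s k ⟧ σ) ≈ₙ evalⁿ (λ v i → ⟦ R v i ⟧ σ) s
    ⟦⟧-translate R (var v)  k = refl
    ⟦⟧-translate R (s ⇒ₜ t) k = trans (reflexive (⟦⟧-impₑ (translate R s) (translate R t) k))
                                      (imp-cong (⟦⟧-translate R s) (⟦⟧-translate R t) k)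
    ⟦⟧-translate R (¬ₜ s)   k = ¬-cong (⟦⟧-translate R s (opposite k))
    ⟦⟧-translate R 1ₜ       k = refl

-- The chain L_{n+1}

[m∸n]∸[m∸o]≡o∸n : ∀ m n {o} → o ≤ m → (m ∸ n) ∸ (m ∸ o) ≡ o ∸ n
[m∸n]∸[m∸o]≡o∸n m n {o} o≤m = begin
  (m ∸ n) ∸ (m ∸ o)                 ≡⟨ ∸-+-assoc m n (m ∸ o) ⟩
  m ∸ (n + (m ∸ o))                 ≡⟨ ≡.cong₂ _∸_ (m∸n+n≡m o≤m) (+-comm (m ∸ o) n) ⟨
  ((m ∸ o) + o) ∸ ((m ∸ o) + n)     ≡⟨ [m+n]∸[m+o]≡n∸o (m ∸ o) o n ⟩
  o ∸ n                             ∎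
  where open ≡.≡-Reasoning

m∸o≡[m∸n]+[n∸o] : ∀ {m n o} → o ≤ n → n ≤ m → m ∸ o ≡ (m ∸ n) + (n ∸ o)
m∸o≡[m∸n]+[n∸o] {m} {n} {o} o≤n n≤m = begin
  m ∸ o               ≡⟨ ≡.cong (_∸ o) (m∸n+n≡m n≤m) ⟨
  (m ∸ n) + n ∸ o     ≡⟨ +-∸-assoc (m ∸ n) o≤n ⟩
  (m ∸ n) + (n ∸ o)   ∎
  where open ≡.≡-Reasoning

[m∸n]+n≡[n∸m]+m : ∀ m n → (m ∸ n) + n ≡ (n ∸ m) + m
[m∸n]+n≡[n∸m]+m m n with m ≤? n
... | yes m≤n = ≡.trans (≡.cong (_+ n) (m≤n⇒m∸n≡0 m≤n)) (≡.sym (m∸n+n≡m m≤n))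
... | no  m≰n = ≡.trans (m∸n+n≡m n≤m) (≡.cong (_+ m) (≡.sym (m≤n⇒m∸n≡0 n≤m)))
  where n≤m = <⇒≤ (≰⇒> m≰n)

[m∸o]∸[n∸o]≤m∸n : ∀ m n o → (m ∸ o) ∸ (n ∸ o) ≤ m ∸ n
[m∸o]∸[n∸o]≤m∸n m n o = begin
  (m ∸ o) ∸ (n ∸ o)   ≡⟨ ∸-+-assoc m o (n ∸ o) ⟩
  m ∸ (o + (n ∸ o))   ≤⟨ ∸-monoʳ-≤ m (m≤n+m∸n n o) ⟩
  m ∸ n               ∎
  where open ≤-Reasoning

module Łukasiewicz (n : ℕ) where
  open ≡.≡-Reasoning

  L-eval : (ℕ → ℕ) → Term → ℕ
  L-eval = Alg.eval _≡_ (L-imp n) (L-neg n) n (_≤ n)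

  L-eval-≤ : ∀ {ρ} → (∀ v → ρ v ≤ n) → ∀ s → L-eval ρ s ≤ n
  L-eval-≤ ρ≤n (var v)  = ρ≤n v
  L-eval-≤ {ρ} ρ≤n (s ⇒ₜ t) = m∸n≤m n (L-eval ρ s ∸ L-eval ρ t)
  L-eval-≤ {ρ} ρ≤n (¬ₜ s)   = m∸n≤m n (L-eval ρ s)
  L-eval-≤ ρ≤n 1ₜ       = ≤-refl

  L-imp-≡-top : ∀ {a b} → a ≤ b → L-imp n a b ≡ n
  L-imp-≡-top a≤b = ≡.cong (n ∸_) (m≤n⇒m∸n≡0 a≤b)

  L-⇒-identityˡ : L-Satisfies n (1ₜ ⇒ₜ var 0) (var 0)
  L-⇒-identityˡ ρ ρ≤n = m∸[m∸n]≡n (ρ≤n 0)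

  L-⇒-transitive : L-Satisfies n ((var 0 ⇒ₜ var 1) ⇒ₜ ((var 1 ⇒ₜ var 2) ⇒ₜ (var 0 ⇒ₜ var 2))) 1ₜ
  L-⇒-transitive ρ ρ≤n = begin
    L-imp n (L-imp n x y) (n ∸ ((n ∸ (y ∸ z)) ∸ (n ∸ (x ∸ z))))
      ≡⟨ ≡.cong (λ w → L-imp n (L-imp n x y) (n ∸ w)) ([m∸n]∸[m∸o]≡o∸n n (y ∸ z) x∸z≤n) ⟩
    L-imp n (L-imp n x y) (n ∸ ((x ∸ z) ∸ (y ∸ z)))
      ≡⟨ L-imp-≡-top (∸-monoʳ-≤ n ([m∸o]∸[n∸o]≤m∸n x y z)) ⟩
    n ∎
    where
    x = ρ 0
    y = ρ 1
    z = ρ 2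
    x∸z≤n = ≤-trans (m∸n≤m x z) (ρ≤n 0)

  L-⇒-symmetric-join : L-Satisfies n ((var 0 ⇒ₜ var 1) ⇒ₜ var 1) ((var 1 ⇒ₜ var 0) ⇒ₜ var 0)
  L-⇒-symmetric-join ρ ρ≤n = ≡.cong (n ∸_) (begin
    (n ∸ (x ∸ y)) ∸ y   ≡⟨ ∸-+-assoc n (x ∸ y) y ⟩
    n ∸ ((x ∸ y) + y)   ≡⟨ ≡.cong (n ∸_) ([m∸n]+n≡[n∸m]+m x y) ⟩
    n ∸ ((y ∸ x) + x)   ≡⟨ ∸-+-assoc n (y ∸ x) x ⟨
    (n ∸ (y ∸ x)) ∸ x   ∎)
    where
    x = ρ 0
    y = ρ 1

  L-contraposition : L-Satisfies n (((¬ₜ var 1) ⇒ₜ (¬ₜ var 0)) ⇒ₜ (var 0 ⇒ₜ var 1)) 1ₜ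
  L-contraposition ρ ρ≤n = begin
    L-imp n (n ∸ ((n ∸ y) ∸ (n ∸ x))) (L-imp n x y)
      ≡⟨ ≡.cong (λ w → L-imp n (n ∸ w) (L-imp n x y)) ([m∸n]∸[m∸o]≡o∸n n y (ρ≤n 0)) ⟩
    L-imp n (L-imp n x y) (L-imp n x y)
      ≡⟨ L-imp-≡-top (≤-refl {L-imp n x y}) ⟩
    n ∎
    where
    x = ρ 0
    y = ρ 1

-- L_{n+1} as the thresholds in 𝔹^[n]

does-all? : ∀ {a p} {A : Set a} {P : A → Set p} (P? : Decidable P) xs →
            does (all? P? xs) ≡ all (does ∘ P?) xs
does-all? P? []       = ≡.refl
does-all? P? (x ∷ xs) = ≡.cong (does (P? x) ∧ᵇ_) (does-all? P? xs)

-- The image of c/n: false on the first n ∸ c coordinates and true on the last c.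
threshold : (n c : ℕ) → Fin n → Bool
threshold n c k = (n ∸ c) ≤ᵇ toℕ k

threshold-true : ∀ {n} c (k : Fin n) → n ∸ c ≤ toℕ k → threshold n c k ≡ true
threshold-true {n} c k = dec-true (n ∸ c ≤? toℕ k)

threshold-false : ∀ {n} c (k : Fin n) → toℕ k < n ∸ c → threshold n c k ≡ false
threshold-false {n} c k k<n∸c = dec-false (n ∸ c ≤? toℕ k) (<⇒≱ k<n∸c)

suc≤ᵇsuc : ∀ m n → (suc m ≤ᵇ suc n) ≡ (m ≤ᵇ n)
suc≤ᵇsuc zero    n = ≡.refl
suc≤ᵇsuc (suc m) n = ≡.refl

threshold-suc : ∀ {m c} → c ≤ m → (i : Fin m) → threshold (suc m) c (suc i) ≡ threshold m c i
threshold-suc {m} {c} c≤m i =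
  ≡.trans (≡.cong (_≤ᵇ suc (toℕ i)) (+-∸-assoc 1 c≤m)) (suc≤ᵇsuc (m ∸ c) (toℕ i))

prefixJoin-threshold : ∀ {m} (f : Fin m → Bool) →
                       ∃ λ c → c ≤ m × (∀ k → prefixJoin _∨ᵇ_ f k ≡ threshold m c k)
prefixJoin-threshold {zero}  f = 0 , z≤n , λ ()
prefixJoin-threshold {suc m} f with f zero in f₀≡
... | true = suc m , ≤-refl , λ k →
  ≡.trans (all-true k) (≡.sym (threshold-true (suc m) k (≡.subst (_≤ toℕ k) (≡.sym (n∸n≡0 m)) z≤n)))
  where
  all-true : ∀ k → prefixJoin _∨ᵇ_ f k ≡ true
  all-true zero    = f₀≡
  all-true (suc i) = ≡.cong (_∨ᵇ prefixJoin _∨ᵇ_ (f ∘ suc) i) f₀≡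
... | false with prefixJoin-threshold (f ∘ suc)
...   | c , c≤m , f∘suc≗ = c , m≤n⇒m≤1+n c≤m , λ where
  zero    → ≡.trans f₀≡ (≡.sym (threshold-false c zero (m<n⇒0<n∸m (s≤s c≤m))))
  (suc i) → ≡.trans (≡.cong (_∨ᵇ prefixJoin _∨ᵇ_ (f ∘ suc) i) f₀≡)
                    (≡.trans (f∘suc≗ i) (≡.sym (threshold-suc c≤m i)))

residuation : ∀ {n a b K} → a ≤ n →
              (∀ i → i < n ∸ K → n ∸ a ≤ i → n ∸ b ≤ i + K) ⇔ a ∸ b ≤ K
residuation {n} {a} {b} {K} a≤n = mk⇔ to from
  where
  from : a ∸ b ≤ K → ∀ i → i < n ∸ K → n ∸ a ≤ i → n ∸ b ≤ i + K
  from a∸b≤K i _ n∸a≤i with b ≤? a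
  ... | yes b≤a = begin
    n ∸ b              ≡⟨ m∸o≡[m∸n]+[n∸o] b≤a a≤n ⟩
    (n ∸ a) + (a ∸ b)  ≤⟨ +-mono-≤ n∸a≤i a∸b≤K ⟩
    i + K              ∎
    where open ≤-Reasoning
  ... | no  b≰a = begin
    n ∸ b   ≤⟨ ∸-monoʳ-≤ n (<⇒≤ (≰⇒> b≰a)) ⟩
    n ∸ a   ≤⟨ n∸a≤i ⟩
    i       ≤⟨ m≤m+n i K ⟩
    i + K   ∎
    where open ≤-Reasoning

  -- Otherwise i = n ∸ a violates the condition.
  to : (∀ i → i < n ∸ K → n ∸ a ≤ i → n ∸ b ≤ i + K) → a ∸ b ≤ K
  to cond with a ∸ b ≤? K
  ... | yes a∸b≤K = a∸b≤K
  ... | no  a∸b≰K = contradiction (cond (n ∸ a) n∸a<n∸K ≤-refl) (<⇒≱ n∸a+K<n∸b)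
    where
    K<a∸b : K < a ∸ b
    K<a∸b = ≰⇒> a∸b≰K
    b<a : b < a
    b<a   = m∸n≢0⇒n<m (λ a∸b≡0 → <⇒≱ K<a∸b (≡.subst (_≤ K) (≡.sym a∸b≡0) z≤n))
    n∸a<n∸K : n ∸ a < n ∸ K
    n∸a<n∸K = ∸-monoʳ-< (<-≤-trans K<a∸b (m∸n≤m a b)) a≤n
    n∸a+K<n∸b : (n ∸ a) + K < n ∸ b
    n∸a+K<n∸b = ≡.subst ((n ∸ a) + K <_) (≡.sym (m∸o≡[m∸n]+[n∸o] (<⇒≤ b<a) a≤n)) (+-monoʳ-< (n ∸ a) K<a∸b)

module ThresholdEmbedding (n : ℕ) where
  open BN 𝔹 n
  open BooleanPower 𝔹 n
  open Łukasiewicz n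
  open ≡.≡-Reasoning
  open import Relation.Nullary using (¬_)

  ext-threshold : ∀ c j → ext (threshold n c) j ≡ ((n ∸ c) ≤ᵇ j)
  ext-threshold c = ext-toℕ (λ j → (n ∸ c) ≤ᵇ j) (λ j n≤j → dec-true (n ∸ c ≤? j) (≤-trans (m∸n≤m n c) n≤j))

  threshold-Mono : ∀ c → Mono (threshold n c)
  threshold-Mono c i j i≤j =
    does-⇔ (mk⇔ proj₁ (λ p → p , ≤-trans p i≤j)) ((n ∸ c ≤? toℕ i) ×-dec (n ∸ c ≤? toℕ j)) (n ∸ c ≤? toℕ i)

  imp-threshold : ∀ {a} b → a ≤ n → ∀ k → imp (threshold n a) (threshold n b) k ≡ threshold n (L-imp n a b) k
  imp-threshold {a} b a≤n k = begin
    imp (threshold n a) (threshold n b) k   ≡⟨ ≡.cong and (map-cong conjunct (upTo (n ∸ K))) ⟩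
    all (does ∘ Residual?) (upTo (n ∸ K))   ≡⟨ does-all? Residual? (upTo (n ∸ K)) ⟨
    does (all? Residual? (upTo (n ∸ K)))    ≡⟨ does-⇔ condition (all? Residual? _) (n ∸ L-imp n a b ≤? K) ⟩
    threshold n (L-imp n a b) k             ∎
    where
    K = toℕ k
    Residual : ℕ → Set
    Residual i = n ∸ a ≤ i → n ∸ b ≤ i + K
    Residual? : Decidable Residual
    Residual? i = (n ∸ a ≤? i) →-dec (n ∸ b ≤? i + K)
    conjunct : ∀ i → not (ext (threshold n a) i) ∨ᵇ ext (threshold n b) (i + K) ≡ does (Residual? i)
    conjunct i = ≡.cong₂ (λ x y → not x ∨ᵇ y) (ext-threshold a i) (ext-threshold b (i + K))
    a∸b≡n∸L-imp : a ∸ b ≡ n ∸ L-imp n a b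
    a∸b≡n∸L-imp = ≡.sym (m∸[m∸n]≡n (≤-trans (m∸n≤m a b) a≤n))
    condition : All Residual (upTo (n ∸ K)) ⇔ n ∸ L-imp n a b ≤ K
    condition = mk⇔
      (λ all-res → ≡.subst (_≤ K) a∸b≡n∸L-imp
        (Equivalence.to (residuation {b = b} a≤n) (λ i i< → All.lookup all-res (∈-upTo⁺ i<))))
      (λ p → All.tabulate (λ i∈ →
        Equivalence.from (residuation {b = b} {K = K} a≤n) (≡.subst (_≤ K) (≡.sym a∸b≡n∸L-imp) p) _ (∈-upTo⁻ i∈)))

  neg-threshold : ∀ {a} → a ≤ n → ∀ k → neg (threshold n a) k ≡ threshold n (L-neg n a) k
  neg-threshold {a} a≤n k =
    does-⇔ (mk⇔ to from) (¬? (n ∸ a ≤? toℕ (opposite k))) (n ∸ L-neg n a ≤? toℕ k)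
    where
    K = toℕ k
    to : ¬ (n ∸ a ≤ toℕ (opposite k)) → n ∸ L-neg n a ≤ K
    to n∸a≰ rewrite m∸[m∸n]≡n a≤n with a ≤? K
    ... | yes a≤K = a≤K
    ... | no  a≰K = contradiction
      (≡.subst (n ∸ a ≤_) (≡.sym (opposite-prop k)) (∸-monoʳ-≤ n (≰⇒> a≰K))) n∸a≰
    from : n ∸ L-neg n a ≤ K → ¬ (n ∸ a ≤ toℕ (opposite k))
    from a≤K rewrite m∸[m∸n]≡n a≤n | opposite-prop k = <⇒≱ (∸-monoʳ-< (s≤s a≤K) (toℕ<n k))

  𝕀-threshold : ∀ k → 𝕀 k ≡ threshold n n k
  𝕀-threshold k = ≡.sym (threshold-true n k (≡.subst (_≤ toℕ k) (≡.sym (n∸n≡0 n)) z≤n))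

  evalⁿ-threshold : ∀ {ρ} → (∀ v → ρ v ≤ n) → ∀ s → evalⁿ (threshold n ∘ ρ) s ≈ₙ threshold n (L-eval ρ s)
  evalⁿ-threshold ρ≤n (var v)  k = ≡.refl
  evalⁿ-threshold {ρ} ρ≤n (s ⇒ₜ t) k =
    ≡.trans (imp-cong (evalⁿ-threshold ρ≤n s) (evalⁿ-threshold ρ≤n t) k)
            (imp-threshold (L-eval ρ t) (L-eval-≤ ρ≤n s) k)
  evalⁿ-threshold ρ≤n (¬ₜ s)   k = ≡.trans (neg-cong (evalⁿ-threshold ρ≤n s) k)
                                            (neg-threshold (L-eval-≤ ρ≤n s) k)
  evalⁿ-threshold ρ≤n 1ₜ       k = 𝕀-threshold k

-- Identities of L_{n+1} hold in B^[n]

module Transfer {c ℓ : Level} (B : BooleanAlgebra c ℓ) (n : ℕ) where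
  open BooleanAlgebra B
  open BN B n
  open BooleanPower B n
  open Semantics B
  open TwoValuedCompleteness B
  open Translation n
  open Łukasiewicz n
  open ThresholdEmbedding n using (threshold-Mono; 𝕀-threshold; evalⁿ-threshold)
  module 𝔹ⁿ = BooleanPower 𝔹 n
  open import Relation.Binary.Reasoning.Setoid setoid

  module Generic (m : ℕ) where
    Var : Set
    Var = Fin m × Fin n

    -- Coordinate i of variable v is the join of the atoms (v , 0), …, (v , i), which is monotone in i
    -- whatever values the atoms take.
    generic : ℕ → Fin n → BoolExpr Var
    generic v with v <? m
    ... | yes v<m = prefixJoin _∨ₑ_ (λ j → atom (fromℕ< v<m , j))
    ... | no  _   = λ _ → ⊤ₑ

    coordinates : (ℕ → Fun) → Var → Carrier
    coordinates ρ (v , j) = ρ (toℕ v) j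

    generic-in-B : ∀ {ρ} → (∀ v → Mono (ρ v)) → ∀ {v} → v < m → ∀ i → ⟦ generic v i ⟧ (coordinates ρ) ≈ ρ v i
    generic-in-B {ρ} ρ-mono {v} v<m i with v <? m
    ... | yes v<m′ = begin
      ⟦ prefixJoin _∨ₑ_ (λ j → atom (fromℕ< v<m′ , j)) i ⟧ (coordinates ρ)  ≡⟨ ⟦⟧-prefixJoin _ (coordinates ρ) i ⟩
      prefixJoin _∨_ (ρ (toℕ (fromℕ< v<m′))) i                              ≈⟨ prefixJoin-Mono _ (ρ-mono _) i ⟩
      ρ (toℕ (fromℕ< v<m′)) i                                               ≡⟨ ≡.cong (λ w → ρ w i) (toℕ-fromℕ< v<m′) ⟩
      ρ v i                                                                 ∎
    ... | no v≮m = contradiction v<m v≮m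

    generic-in-𝔹 : ∀ τ v → ∃ λ c → c ≤ n × (∀ i → ⟦ generic v i ⟧₂ τ ≡ threshold n c i)
    generic-in-𝔹 τ v with v <? m
    ... | yes v<m = let c , c≤n , prefixJoin≗threshold = prefixJoin-threshold (λ j → τ (fromℕ< v<m , j))
                    in c , c≤n , λ i → ≡.trans (Semantics.⟦⟧-prefixJoin 𝔹 _ τ i) (prefixJoin≗threshold i)
    ... | no  _   = n , ≤-refl , 𝕀-threshold

    level : (Var → Bool) → ℕ → ℕ
    level τ v = proj₁ (generic-in-𝔹 τ v)

    level-≤ : ∀ τ v → level τ v ≤ n
    level-≤ τ v = proj₁ (proj₂ (generic-in-𝔹 τ v))

    translate-in-B : ∀ {ρ} → (∀ v → Mono (ρ v)) → ∀ s → varBound s ≤ m →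
                     ∀ k → ⟦ translate generic s k ⟧ (coordinates ρ) ≈ evalⁿ ρ s k
    translate-in-B {ρ} ρ-mono s s≤m k = trans (⟦⟧-translate (coordinates ρ) generic s k)
      (evalⁿ-cong s (λ v v<s → generic-in-B ρ-mono (<-≤-trans v<s s≤m)) k)

    translate-in-𝔹 : ∀ τ s k → ⟦ translate generic s k ⟧₂ τ ≡ threshold n (L-eval (level τ) s) k
    translate-in-𝔹 τ s k = ≡.trans (𝔹ⁿ.⟦⟧-translate τ generic s k)
      (≡.trans (𝔹ⁿ.evalⁿ-cong s (λ v _ → proj₂ (proj₂ (generic-in-𝔹 τ v))) k)
               (evalⁿ-threshold (level-≤ τ) s k))

    reflect : ∀ p q → (∀ τ → ⟦ p ⟧₂ τ ≡ ⟦ q ⟧₂ τ) → ∀ σ → ⟦ p ⟧ σ ≈ ⟦ q ⟧ σ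
    reflect p q p≡q = two-valued-complete (≡-dec Fin._≟_ Fin._≟_) p q p≡q
      (cartesianProduct (allFin m) (allFin n)) (λ (v , j) → ∈-cartesianProduct⁺ (∈-allFin v) (∈-allFin j))

  evalⁿ-Mono : ∀ {ρ} → (∀ v → Mono (ρ v)) → ∀ s → Mono (evalⁿ ρ s)
  evalⁿ-Mono {ρ} ρ-mono s i j i≤j = begin
    evalⁿ ρ s i ∧ evalⁿ ρ s j  ≈⟨ ∧-cong (translate-in-B ρ-mono s ≤-refl i) (translate-in-B ρ-mono s ≤-refl j) ⟨
    ⟦ φ i ∧ₑ φ j ⟧ σ           ≈⟨ reflect (φ i ∧ₑ φ j) (φ i) in-𝔹 σ ⟩
    ⟦ φ i ⟧ σ                  ≈⟨ translate-in-B ρ-mono s ≤-refl i ⟩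
    evalⁿ ρ s i                ∎
    where
    open Generic (varBound s)
    φ = translate generic s
    σ = coordinates ρ
    in-𝔹 : ∀ τ → ⟦ φ i ⟧₂ τ ∧ᵇ ⟦ φ j ⟧₂ τ ≡ ⟦ φ i ⟧₂ τ
    in-𝔹 τ = ≡.trans (≡.cong₂ _∧ᵇ_ (translate-in-𝔹 τ s i) (translate-in-𝔹 τ s j))
               (≡.trans (threshold-Mono (L-eval (level τ) s) i j i≤j) (≡.sym (translate-in-𝔹 τ s i)))

  L-identities-hold : ∀ s t → L-Satisfies n s t → Alg.Satisfies _≈ₙ_ imp neg 𝕀 Mono s t
  L-identities-hold s t s≈t ρ ρ-mono k = begin
    evalⁿ ρ s k   ≈⟨ translate-in-B ρ-mono s (m≤m⊔n (varBound s) (varBound t)) k ⟨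
    ⟦ φ s k ⟧ σ   ≈⟨ reflect (φ s k) (φ t k) in-𝔹 σ ⟩
    ⟦ φ t k ⟧ σ   ≈⟨ translate-in-B ρ-mono t (m≤n⊔m (varBound s) (varBound t)) k ⟩
    evalⁿ ρ t k   ∎
    where
    open Generic (varBound s ⊔ varBound t)
    φ = translate generic
    σ = coordinates ρ
    in-𝔹 : ∀ τ → ⟦ φ s k ⟧₂ τ ≡ ⟦ φ t k ⟧₂ τ
    in-𝔹 τ = ≡.trans (translate-in-𝔹 τ s k)
               (≡.trans (≡.cong (λ a → threshold n a k) (s≈t (level τ) (level-≤ τ)))
                        (≡.sym (translate-in-𝔹 τ t k)))

  env : Fun → Fun → Fun → ℕ → Fun
  env x y z 0 = x
  env x y z 1 = y
  env x y z 2 = z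
  env x y z _ = 𝕀

  env-Mono : ∀ {x y z} → Mono x → Mono y → Mono z → ∀ v → Mono (env x y z v)
  env-Mono x-mono y-mono z-mono 0 = x-mono
  env-Mono x-mono y-mono z-mono 1 = y-mono
  env-Mono x-mono y-mono z-mono 2 = z-mono
  env-Mono x-mono y-mono z-mono (suc (suc (suc _))) = 𝕀-Mono

  L-identities-hold₃ : ∀ s t → L-Satisfies n s t → ∀ {x y z} → Mono x → Mono y → Mono z →
                       evalⁿ (env x y z) s ≈ₙ evalⁿ (env x y z) t
  L-identities-hold₃ s t s≈t x-mono y-mono z-mono =
    L-identities-hold s t s≈t _ (env-Mono x-mono y-mono z-mono)

theorem1 : {c ℓ : Level} (B : BooleanAlgebra c ℓ) (n : ℕ) → 1 ≤ n →
    IsNValuedWajsberg n (BN._≈ₙ_ B n) (BN.imp B n) (BN.neg B n) (BN.𝕀 B n) (BN.Mono B n)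
theorem1 B n _ = (closed , congruent , ⇒-identityˡ , ⇒-transitive , ⇒-symmetric-join , contraposition)
               , L-identities-hold
  where
  open BooleanAlgebra B
  open BooleanPower B n
  open Transfer B n
  open Łukasiewicz n

  closed = (λ _ _ x-mono y-mono → evalⁿ-Mono (env-Mono x-mono y-mono 𝕀-Mono) (var 0 ⇒ₜ var 1))
         , (λ _ x-mono → evalⁿ-Mono (env-Mono x-mono 𝕀-Mono 𝕀-Mono) (¬ₜ var 0))
         , 𝕀-Mono

  congruent = (λ _ _ _ → refl)
            , (λ _ _ _ _ f≈g k → sym (f≈g k))
            , (λ _ _ _ _ _ _ f≈g g≈h k → trans (f≈g k) (g≈h k))
            , (λ _ _ _ _ _ _ _ _ → imp-cong)
            , (λ _ _ _ _ → neg-cong)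

  ⇒-identityˡ = λ _ x-mono →
    L-identities-hold₃ (1ₜ ⇒ₜ var 0) (var 0) L-⇒-identityˡ x-mono x-mono x-mono
  ⇒-transitive = λ _ _ _ x-mono y-mono z-mono →
    L-identities-hold₃ ((var 0 ⇒ₜ var 1) ⇒ₜ ((var 1 ⇒ₜ var 2) ⇒ₜ (var 0 ⇒ₜ var 2))) 1ₜ
                       L-⇒-transitive x-mono y-mono z-mono
  ⇒-symmetric-join = λ _ _ x-mono y-mono →
    L-identities-hold₃ ((var 0 ⇒ₜ var 1) ⇒ₜ var 1) ((var 1 ⇒ₜ var 0) ⇒ₜ var 0)
                       L-⇒-symmetric-join x-mono y-mono y-mono
  contraposition = λ _ _ x-mono y-mono →
    L-identities-hold₃ (((¬ₜ var 1) ⇒ₜ (¬ₜ var 0)) ⇒ₜ (var 0 ⇒ₜ var 1)) 1ₜ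
                       L-contraposition x-mono y-mono y-mono
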